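{- Let $\{p_1,\dots,p_k\}$ and $\{q_1,\dots,q_\ell\}$ be two disjoint sets of distinct primes, and put $A=\mathbb{Z}[\frac{1}{p_1},\dots,\frac{1}{p_k}]/\mathbb{Z}$ and $B=\mathbb{Z}[\frac{1}{q_1},\dots,\frac{1}{q_\ell}]/\mathbb{Z}$. Then $\operatorname{QHom}(A,B)=0$ and $\operatorname{QHom}(B,A)=0$.
   Context: For primes $r_1,\dots,r_m$, $\mathbb{Z}[\frac{1}{r_1},\dots,\frac{1}{r_m}]$ is the subring of $\mathbb{Q}$ generated by $\mathbb{Z}$ and the $1/r_i$, and the quotient is by the additive subgroup $\mathbb{Z}$. For abelian groups $X,Y$, a function $f:X\to Y$ is an almost-homomorphism if the set $\{f(a+b)-f(a)-f(b):a,b\in X\}$ is finite, and almost-zero if its image $\{f(a):a\in X\}$ is finite. The almost-homomorphisms form a group $\operatorname{AHom}(X,Y)$ under pointwise addition, with subgroup $\operatorname{Az}(X,Y)$ of almost-zero functions, and $\operatorname{QHom}(X,Y)=\operatorname{AHom}(X,Y)/\operatorname{Az}(X,Y)$. -}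

module Defs where

open import Data.Nat using (ℕ; _^_)
open import Data.Nat.Divisibility using (_∣_)
open import Data.List using (List)
open import Data.Nat.ListAction using (product)
open import Data.List.Relation.Unary.Any using (Any)
open import Data.Product using (Σ; ∃; _×_)
open import Data.Rational using (ℚ; ↧ₙ_; _+_; _-_)
open import Relation.Binary.PropositionalEquality using (_≡_)

IsInt : ℚ → Set
IsInt r = ↧ₙ r ≡ 1

_≈ℤ_ : ℚ → ℚ → Set
r ≈ℤ s = IsInt (r - s)

-- Membership in the ring ℤ[1/p₁,…,1/pₖ] ⊆ ℚ, for ps = [p₁,…,pₖ]:
-- r = m / (p₁⋯pₖ)ⁿ for some n, i.e. the denominator of r divides
-- (p₁⋯pₖ)ⁿ for some n.
InZinv : List ℕ → ℚ → Set
InZinv ps r = ∃ λ (n : ℕ) → ↧ₙ r ∣ (product ps) ^ n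

FiniteModℤ : (ℚ → Set) → Set
FiniteModℤ S = Σ (List ℚ) λ L → ∀ x → S x → Any (λ c → x ≈ℤ c) L

-- A function ℤ[1/ps]/ℤ → ℤ[1/qs]/ℤ, presented by a function on ℚ
-- (only its values on ℤ[1/ps] matter) which maps ℤ[1/ps] into ℤ[1/qs]
-- and respects equality modulo ℤ.
IsMap : List ℕ → List ℕ → (ℚ → ℚ) → Set
IsMap ps qs f =
  (∀ a → InZinv ps a → InZinv qs (f a)) ×
  (∀ a a' → InZinv ps a → InZinv ps a' → a ≈ℤ a' → f a ≈ℤ f a')

IsAlmostHom : List ℕ → (ℚ → ℚ) → Set
IsAlmostHom ps f = FiniteModℤ λ d →
  ∃ λ a → ∃ λ b → InZinv ps a × InZinv ps b × (d ≡ (f (a + b) - f a) - f b)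

IsAlmostZero : List ℕ → (ℚ → ℚ) → Set
IsAlmostZero ps f = FiniteModℤ λ y → ∃ λ a → InZinv ps a × (y ≡ f a)

QHomZero : List ℕ → List ℕ → Set
QHomZero ps qs = ∀ (f : ℚ → ℚ) → IsMap ps qs f → IsAlmostHom ps f → IsAlmostZero ps f

-- Let f be an almost-homomorphism ℤ[1/ps]/ℤ → ℤ[1/qs]/ℤ and N a common denominator of its
-- finitely many defects, so that N·(f(a+b) − f a − f b) ∈ ℤ.  Then N·f(b) ∈ ℤ for b ∈ ℤ, and
-- by induction N·(f(k a) − k f(a)) ∈ ℤ.  For a ∈ ℤ[1/ps] some k = (∏ ps)ⁿ makes k a an integer,
-- so the denominator of f(a) divides N·k; it divides a power of ∏ qs, hence is coprime to k, and
-- therefore divides N.  Thus every value of f lies in (1/N)ℤ, which has N classes modulo ℤ.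
module Submission where

open import Defs
open import Data.Integer as ℤ using (ℤ; +_; ∣_∣)
import Data.Integer.Properties as ℤ
open import Data.Integer.DivMod using (_%ℕ_; _/ℕ_; n%ℕd<d; a≡a%ℕn+[a/ℕn]*n)
import Data.Integer.Tactic.RingSolver as ℤ-Solver
open import Data.List using (List; map; upTo)
open import Data.List.Membership.Propositional using (_∉_; find)
open import Data.List.Membership.Propositional.Properties using (∈-upTo⁺; ∈-map⁺)
open import Data.List.Relation.Binary.Disjoint.Propositional using (Disjoint)
open import Data.List.Relation.Unary.All as All using (All; []; _∷_)
import Data.List.Relation.Unary.All.Properties as All
open import Data.List.Relation.Unary.Any as Any using (Any; here; there)
import Data.List.Relation.Unary.Any.Properties as Any
open import Data.List.Relation.Unary.Unique.Propositional using (Unique)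
open import Data.Nat as ℕ using (ℕ; zero; suc; _^_; NonZero)
open import Data.Nat.Coprimality as Coprime using (Coprime; coprime?; coprime-divisor; 1-coprimeTo)
open import Data.Nat.Divisibility using (_∣_; divides; ∣1⇒≡1; ∣-trans; ∣-refl)
open import Data.Nat.ListAction using (product)
open import Data.Nat.ListAction.Properties using (∈⇒∣product; product≢0)
open import Data.Nat.Primality using (Prime; prime⇒irreducible; ¬prime[1])
import Data.Nat.Properties as ℕ
open import Data.Product using (∃; _×_; _,_; proj₁; proj₂)
open import Data.Rational using (ℚ; mkℚ; ↧ₙ_; _+_; _-_; _*_; -_; 0ℚ; 1ℚ; 1/_)
open import Data.Rational.Properties
  using (toℚᵘ-injective; toℚᵘ-homo-+; toℚᵘ-homo-*; toℚᵘ-cong; +-*-commutativeRing; _≟_;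
         +-identityʳ; *-identityˡ; *-identityʳ; *-zeroˡ; *-distribʳ-+; *-inverseʳ)
open import Data.Rational.Unnormalised using (*≡*)
open import Data.Rational.Unnormalised.Properties using (≃-trans; ≃-sym)
open import Data.Sum using (inj₁; inj₂)
open import Data.Empty using (⊥-elim)
open import Level using (0ℓ)
open import Relation.Binary.PropositionalEquality
open import Relation.Nullary.Decidable using (recompute; dec⇒maybe)
open import Tactic.RingSolver using (solve-∀)
open import Tactic.RingSolver.Core.AlmostCommutativeRing using (AlmostCommutativeRing; fromCommutativeRing)

coprime-*ˡ : ∀ {a b c} → Coprime a c → Coprime b c → Coprime (a ℕ.* b) c
coprime-*ˡ a⊥c b⊥c (d∣ab , d∣c) =
  b⊥c (coprime-divisor (λ (x∣d , x∣a) → a⊥c (x∣a , ∣-trans x∣d d∣c)) d∣ab , d∣c)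

coprime-^ˡ : ∀ {a b} n → Coprime a b → Coprime (a ^ n) b
coprime-^ˡ {b = b} zero    a⊥b = 1-coprimeTo b
coprime-^ˡ         (suc n) a⊥b = coprime-*ˡ a⊥b (coprime-^ˡ n a⊥b)

coprime-^ : ∀ {a b} m n → Coprime a b → Coprime (a ^ m) (b ^ n)
coprime-^ m n a⊥b = coprime-^ˡ m (Coprime.sym (coprime-^ˡ n (Coprime.sym a⊥b)))

coprime-∣ˡ : ∀ {a b c} → a ∣ b → Coprime b c → Coprime a c
coprime-∣ˡ a∣b b⊥c (d∣a , d∣c) = b⊥c (∣-trans d∣a a∣b , d∣c)

distinct-primes-coprime : ∀ {p q} → Prime p → Prime q → p ≢ q → Coprime p q
distinct-primes-coprime p-prime q-prime p≢q (d∣p , d∣q) with prime⇒irreducible p-prime d∣p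
... | inj₁ d≡1 = d≡1
... | inj₂ refl with prime⇒irreducible q-prime d∣q
...   | inj₁ refl = ⊥-elim (¬prime[1] p-prime)
...   | inj₂ p≡q  = ⊥-elim (p≢q p≡q)

prime-coprime-product : ∀ {p qs} → Prime p → All Prime qs → p ∉ qs → Coprime p (product qs)
prime-coprime-product {p} p-prime []                  p∉ = Coprime.sym (1-coprimeTo p)
prime-coprime-product     p-prime (q-prime ∷ qs-prime) p∉ =
  Coprime.sym (coprime-*ˡ
    (Coprime.sym (distinct-primes-coprime p-prime q-prime (λ p≡q → p∉ (here p≡q))))
    (Coprime.sym (prime-coprime-product p-prime qs-prime (λ p∈ → p∉ (there p∈)))))

disjoint-primes-coprime-products : ∀ {ps qs} → All Prime ps → All Prime qs → Disjoint ps qs →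
                                   Coprime (product ps) (product qs)
disjoint-primes-coprime-products []                   qs-prime disjoint = 1-coprimeTo _
disjoint-primes-coprime-products (p-prime ∷ ps-prime) qs-prime disjoint =
  coprime-*ˡ (prime-coprime-product p-prime qs-prime (λ p∈ → disjoint (here refl , p∈)))
             (disjoint-primes-coprime-products ps-prime qs-prime
               (λ (v∈ps , v∈qs) → disjoint (there v∈ps , v∈qs)))

-- The zero test lets the solver cancel coefficients such as 1 + (−1).
ℚ-ring : AlmostCommutativeRing 0ℓ 0ℓ
ℚ-ring = fromCommutativeRing +-*-commutativeRing (λ x → dec⇒maybe (0ℚ ≟ x))

fromℤ : ℤ → ℚ
fromℤ z = mkℚ z 0 (λ (_ , d∣1) → ∣1⇒≡1 d∣1)

fromℕ : ℕ → ℚ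
fromℕ n = fromℤ (+ n)

fromℤ-+ : ∀ a b → fromℤ (a ℤ.+ b) ≡ fromℤ a + fromℤ b
fromℤ-+ a b = sym (toℚᵘ-injective (≃-trans (toℚᵘ-homo-+ (fromℤ a) (fromℤ b)) (*≡* (cross a b))))
  where
  cross : ∀ a b → (a ℤ.* + 1 ℤ.+ b ℤ.* + 1) ℤ.* + 1 ≡ (a ℤ.+ b) ℤ.* + 1
  cross = ℤ-Solver.solve-∀

fromℤ-* : ∀ a b → fromℤ (a ℤ.* b) ≡ fromℤ a * fromℤ b
fromℤ-* a b = sym (toℚᵘ-injective (≃-trans (toℚᵘ-homo-* (fromℤ a) (fromℤ b)) (*≡* refl)))

fromℤ-neg : ∀ a → fromℤ (ℤ.- a) ≡ - fromℤ a
fromℤ-neg (+ zero)    = refl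
fromℤ-neg (+ suc n)   = refl
fromℤ-neg ℤ.-[1+ n ]  = refl

fromℕ-suc : ∀ k → fromℕ (suc k) ≡ fromℕ k + 1ℚ
fromℕ-suc k = trans (cong fromℕ (ℕ.+-comm 1 k)) (fromℤ-+ (+ k) (+ 1))

fromℕ-* : ∀ m n → fromℕ (m ℕ.* n) ≡ fromℕ m * fromℕ n
fromℕ-* m n = trans (cong fromℤ (ℤ.pos-* m n)) (fromℤ-* (+ m) (+ n))

Integral : ℚ → Set
Integral r = ∃ λ z → r ≡ fromℤ z

IsInt⇒Integral : ∀ r → IsInt r → Integral r
IsInt⇒Integral (mkℚ z zero _) refl = z , refl

Integral⇒IsInt : ∀ {r} → Integral r → IsInt r
Integral⇒IsInt (z , refl) = refl

integral-fromℤ : ∀ z → Integral (fromℤ z)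
integral-fromℤ z = z , refl

integral-+ : ∀ {r s} → Integral r → Integral s → Integral (r + s)
integral-+ (a , refl) (b , refl) = a ℤ.+ b , sym (fromℤ-+ a b)

integral-* : ∀ {r s} → Integral r → Integral s → Integral (r * s)
integral-* (a , refl) (b , refl) = a ℤ.* b , sym (fromℤ-* a b)

integral-neg : ∀ {r} → Integral r → Integral (- r)
integral-neg (a , refl) = ℤ.- a , sym (fromℤ-neg a)

integral-- : ∀ {r s} → Integral r → Integral s → Integral (r - s)
integral-- r∈ℤ s∈ℤ = integral-+ r∈ℤ (integral-neg s∈ℤ)

integral⇒InZinv : ∀ ps {r} → Integral r → InZinv ps r
integral⇒InZinv ps r∈ℤ = 0 , subst (_∣ 1) (sym (Integral⇒IsInt r∈ℤ)) ∣-refl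

↧ₙ∣⇒integral-* : ∀ K x → ↧ₙ x ∣ K → Integral (fromℕ K * x)
↧ₙ∣⇒integral-* K x@(mkℚ n d _) (divides q refl) =
  + q ℤ.* n , toℚᵘ-injective (≃-trans (toℚᵘ-homo-* (fromℕ K) x) (*≡* cross))
  where
  regroup : ∀ q D n → ((q ℤ.* D) ℤ.* n) ℤ.* + 1 ≡ (q ℤ.* n) ℤ.* (+ 1 ℤ.* D)
  regroup = ℤ-Solver.solve-∀
  cross : (+ (q ℕ.* suc d) ℤ.* n) ℤ.* + 1 ≡ (+ q ℤ.* n) ℤ.* (+ 1 ℤ.* + suc d)
  cross = trans (cong (λ m → (m ℤ.* n) ℤ.* + 1) (ℤ.pos-* q (suc d)))
                (regroup (+ q) (+ suc d) n)

integral-*⇒↧ₙ∣ : ∀ K x → Integral (fromℕ K * x) → ↧ₙ x ∣ K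
integral-*⇒↧ₙ∣ K x@(mkℚ n d n⊥d) (z , Kx≡z) = coprime-divisor d⊥n (divides ∣ z ∣ ∣n∣K≡∣z∣d)
  where
  d⊥n : Coprime (suc d) ∣ n ∣
  d⊥n = Coprime.sym (recompute (coprime? ∣ n ∣ (suc d)) n⊥d)
  cross : (+ K ℤ.* n) ℤ.* + 1 ≡ z ℤ.* (+ 1 ℤ.* + suc d)
  cross with ≃-trans (≃-sym (toℚᵘ-homo-* (fromℕ K) x)) (toℚᵘ-cong Kx≡z)
  ... | *≡* eq = eq
  ∣n∣K≡∣z∣d : ∣ n ∣ ℕ.* K ≡ ∣ z ∣ ℕ.* suc d
  ∣n∣K≡∣z∣d = begin
    ∣ n ∣ ℕ.* K                   ≡⟨ ℕ.*-comm ∣ n ∣ K ⟩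
    K ℕ.* ∣ n ∣                   ≡⟨ ℤ.abs-* (+ K) n ⟨
    ∣ + K ℤ.* n ∣                 ≡⟨ cong ∣_∣ (ℤ.*-identityʳ (+ K ℤ.* n)) ⟨
    ∣ (+ K ℤ.* n) ℤ.* + 1 ∣       ≡⟨ cong ∣_∣ cross ⟩
    ∣ z ℤ.* (+ 1 ℤ.* + suc d) ∣   ≡⟨ cong (λ m → ∣ z ℤ.* m ∣) (ℤ.*-identityˡ (+ suc d)) ⟩
    ∣ z ℤ.* + suc d ∣             ≡⟨ ℤ.abs-* z (+ suc d) ⟩
    ∣ z ∣ ℕ.* suc d               ∎
    where open ≡-Reasoning

InZinv-multiple : ∀ ps k a → InZinv ps a → InZinv ps (fromℕ k * a)
InZinv-multiple ps k a (e , ↧a∣) =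
  e , integral-*⇒↧ₙ∣ P^e (fromℕ k * a)
        (subst Integral (reorder (fromℕ k) (fromℕ P^e) a)
          (integral-* (integral-fromℤ (+ k)) (↧ₙ∣⇒integral-* P^e a ↧a∣)))
  where
  P^e = product ps ^ e
  reorder : ∀ k p a → k * (p * a) ≡ p * (k * a)
  reorder = solve-∀ ℚ-ring

fractions : (N : ℕ) .{{_ : NonZero N}} → List ℚ
fractions N = map (λ r → fromℕ r * 1/ fromℕ N) (upTo N)

remainder-quotient : ∀ n i y R Q → n * i ≡ 1ℚ → n * y ≡ R + Q * n → y - R * i ≡ Q
remainder-quotient n i y R Q n*i≡1 ny≡R+Qn = begin
  y - R * i               ≡⟨ cong (λ u → u - R * i) y*[n*i]≡y ⟨
  y * (n * i) - R * i     ≡⟨ factor y n i R ⟩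
  (n * y - R) * i         ≡⟨ cong (λ u → (u - R) * i) ny≡R+Qn ⟩
  ((R + Q * n) - R) * i   ≡⟨ cancel Q n i R ⟩
  Q * (n * i)             ≡⟨ cong (Q *_) n*i≡1 ⟩
  Q * 1ℚ                  ≡⟨ *-identityʳ Q ⟩
  Q                       ∎
  where
  open ≡-Reasoning
  y*[n*i]≡y : y * (n * i) ≡ y
  y*[n*i]≡y = trans (cong (y *_) n*i≡1) (*-identityʳ y)
  factor : ∀ y n i R → y * (n * i) - R * i ≡ (n * y - R) * i
  factor = solve-∀ ℚ-ring
  cancel : ∀ Q n i R → ((R + Q * n) - R) * i ≡ Q * (n * i)
  cancel = solve-∀ ℚ-ring

integral-*⇒≈fraction : ∀ N .{{_ : NonZero N}} y → Integral (fromℕ N * y) →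
                        Any (y ≈ℤ_) (fractions N)
integral-*⇒≈fraction N y (z , Ny≡z) =
  Any.map⁺ (Any.map (λ { refl → Integral⇒IsInt (z /ℕ N , y-r/N≡q) }) (∈-upTo⁺ (n%ℕd<d z N)))
  where
  z≡r+qN : fromℤ z ≡ fromℕ (z %ℕ N) + fromℤ (z /ℕ N) * fromℕ N
  z≡r+qN = trans (cong fromℤ (a≡a%ℕn+[a/ℕn]*n z N))
             (trans (fromℤ-+ (+ (z %ℕ N)) (z /ℕ N ℤ.* + N))
                    (cong (λ u → fromℕ (z %ℕ N) + u) (fromℤ-* (z /ℕ N) (+ N))))
  y-r/N≡q : y - fromℕ (z %ℕ N) * 1/ fromℕ N ≡ fromℤ (z /ℕ N)
  y-r/N≡q = remainder-quotient (fromℕ N) (1/ fromℕ N) y (fromℕ (z %ℕ N)) (fromℤ (z /ℕ N))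
              (*-inverseʳ (fromℕ N)) (trans Ny≡z z≡r+qN)

commonDenominator : List ℚ → ℕ
commonDenominator cs = product (map ↧ₙ_ cs)

commonDenominator-nonZero : ∀ cs → NonZero (commonDenominator cs)
commonDenominator-nonZero cs = product≢0 (All.map⁺ (All.universal ↧ₙ-nonZero cs))
  where
  ↧ₙ-nonZero : ∀ c → NonZero (↧ₙ c)
  ↧ₙ-nonZero (mkℚ _ _ _) = _

≈member⇒integral-* : ∀ d {cs} → Any (d ≈ℤ_) cs → Integral (fromℕ (commonDenominator cs) * d)
≈member⇒integral-* d {cs} d≈member with find d≈member
... | c , c∈cs , d≈c = subst Integral (split (fromℕ N) d c)
  (integral-+ (integral-* (integral-fromℤ (+ N)) (IsInt⇒Integral (d - c) d≈c))
              (↧ₙ∣⇒integral-* N c (∈⇒∣product (∈-map⁺ ↧ₙ_ c∈cs))))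
  where
  N = commonDenominator cs
  split : ∀ n d c → n * (d - c) + n * c ≡ n * d
  split = solve-∀ ℚ-ring

defect : (ℚ → ℚ) → ℚ → ℚ → ℚ
defect f a b = (f (a + b) - f a) - f b

module QuasiAdditive
  (ps qs : List ℕ) (f : ℚ → ℚ) (f-map : IsMap ps qs f) (N : ℕ)
  (N*defect-integral : ∀ {a b} → InZinv ps a → InZinv ps b → Integral (fromℕ N * defect f a b))
  where

  private
    n : ℚ
    n = fromℕ N

    0∈ : InZinv ps 0ℚ
    0∈ = integral⇒InZinv ps (integral-fromℤ (+ 0))

  N*f0-integral : Integral (n * f 0ℚ)
  N*f0-integral = subst Integral (negate-defect n (f 0ℚ))
    (integral-neg (subst (λ w → Integral (n * ((f w - f 0ℚ) - f 0ℚ))) (+-identityʳ 0ℚ)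
                         (N*defect-integral 0∈ 0∈)))
    where
    negate-defect : ∀ n x → - (n * ((x - x) - x)) ≡ n * x
    negate-defect = solve-∀ ℚ-ring

  N*f-integral-on-ℤ : ∀ {b} → Integral b → Integral (n * f b)
  N*f-integral-on-ℤ {b} b∈ℤ = subst Integral (split n (f b) (f 0ℚ))
    (integral-+ (integral-* (integral-fromℤ (+ N)) (IsInt⇒Integral (f b - f 0ℚ) f[b]≈f[0]))
                N*f0-integral)
    where
    f[b]≈f[0] : f b ≈ℤ f 0ℚ
    f[b]≈f[0] = proj₂ f-map b 0ℚ (integral⇒InZinv ps b∈ℤ) 0∈
                  (Integral⇒IsInt (integral-- b∈ℤ (integral-fromℤ (+ 0))))
    split : ∀ n x y → n * (x - y) + n * y ≡ n * x
    split = solve-∀ ℚ-ring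

  N*f-multiple : ∀ a → InZinv ps a → ∀ k → Integral (n * (f (fromℕ k * a) - fromℕ k * f a))
  N*f-multiple a a∈ zero
    -- fromℕ 0 is definitionally 0ℚ
    rewrite *-zeroˡ a | *-zeroˡ (f a) | +-identityʳ (f 0ℚ) = N*f0-integral
  N*f-multiple a a∈ (suc k)
    rewrite fromℕ-suc k | *-distribʳ-+ a (fromℕ k) 1ℚ | *-identityˡ a =
      subst Integral (telescope n (f (fromℕ k * a)) (f (fromℕ k * a + a)) (fromℕ k) (f a))
        (integral-+ (N*f-multiple a a∈ k) (N*defect-integral (InZinv-multiple ps k a a∈) a∈))
    where
    telescope : ∀ n x y K g → n * (x - K * g) + n * ((y - x) - g) ≡ n * (y - (K + 1ℚ) * g)
    telescope = solve-∀ ℚ-ring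

  N*f-integral : Coprime (product qs) (product ps) → ∀ {a} → InZinv ps a → Integral (n * f a)
  N*f-integral qs⊥ps {a} a∈@(e , ↧a∣P^e) =
    ↧ₙ∣⇒integral-* N (f a) (coprime-divisor ↧fa⊥P^e ↧fa∣P^eN)
    where
    P^e = product ps ^ e
    ↧fa⊥P^e : Coprime (↧ₙ f a) P^e
    ↧fa⊥P^e = let j , ↧fa∣Q^j = proj₁ f-map a a∈ in coprime-∣ˡ ↧fa∣Q^j (coprime-^ j e qs⊥ps)
    N*P^e*fa-integral : Integral (n * (fromℕ P^e * f a))
    N*P^e*fa-integral = subst Integral (cancel n (f (fromℕ P^e * a)) (fromℕ P^e) (f a))
      (integral-- (N*f-integral-on-ℤ (↧ₙ∣⇒integral-* P^e a ↧a∣P^e)) (N*f-multiple a a∈ P^e))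
      where
      cancel : ∀ n x K g → n * x - n * (x - K * g) ≡ n * (K * g)
      cancel = solve-∀ ℚ-ring
    ↧fa∣P^eN : ↧ₙ f a ∣ P^e ℕ.* N
    ↧fa∣P^eN = integral-*⇒↧ₙ∣ (P^e ℕ.* N) (f a)
      (subst Integral (trans (regroup n (fromℕ P^e) (f a)) (cong (_* f a) (sym (fromℕ-* P^e N))))
             N*P^e*fa-integral)
      where
      regroup : ∀ n p g → n * (p * g) ≡ (p * n) * g
      regroup = solve-∀ ℚ-ring

coprime-products⇒QHomZero : ∀ ps qs → Coprime (product qs) (product ps) → QHomZero ps qs
coprime-products⇒QHomZero ps qs qs⊥ps f f-map (defects , defects-complete) =
  fractions N , λ { _ (a , a∈ , refl) → integral-*⇒≈fraction N (f a) (N*f-integral qs⊥ps a∈) }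
  where
  N = commonDenominator defects
  instance
    N≢0 : NonZero N
    N≢0 = commonDenominator-nonZero defects
  open QuasiAdditive ps qs f f-map N
    (λ {a} {b} a∈ b∈ →
       ≈member⇒integral-* (defect f a b) (defects-complete _ (a , b , a∈ , b∈ , refl)))

mainTheorem13 : (ps qs : List ℕ) → All Prime ps → All Prime qs →
    Unique ps → Unique qs → Disjoint ps qs →
    QHomZero ps qs × QHomZero qs ps
mainTheorem13 ps qs ps-prime qs-prime _ _ disjoint =
  coprime-products⇒QHomZero ps qs (Coprime.sym ps⊥qs) , coprime-products⇒QHomZero qs ps ps⊥qs
  where
  ps⊥qs : Coprime (product ps) (product qs)
  ps⊥qs = disjoint-primes-coprime-products ps-prime qs-prime disjoint
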